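{- Let $X$ be a set and $R\subseteq X\times X$ a symmetric, irreflexive collusion. Then $R$ has no cycle of odd length: there is no odd $n\geq 1$ and elements $x_0,x_1,\dots,x_n\in X$ with $x_n=x_0$ and $x_iRx_{i+1}$ for all $0\le i<n$.
   Context: $R$ is collusive iff $\forall x,y,z,w\in X\,\big((xRy\wedge xRz\wedge wRy)\Rightarrow wRz\big)$; a collusion is a collusive relation that is total ($\forall x\exists y.\ xRy$) and surjective ($\forall x\exists y.\ yRx$); irreflexive means $\forall x.\ \neg xRx$. Cycles are closed sequences of $R$-steps, vertices not required to be distinct. -}

module Defs where

open import Level using (Level; _⊔_)
open import Data.Nat using (ℕ; suc; _<_)
open import Data.Product using (∃; ∃-syntax; _×_)
open import Relation.Nullary using (¬_)
open import Relation.Binary.PropositionalEquality using (_≡_)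
open import Relation.Binary.Core using (Rel)

Collusive : ∀ {a ℓ} {X : Set a} → Rel X ℓ → Set (a ⊔ ℓ)
Collusive {X = X} R = ∀ (x y z w : X) → R x y → R x z → R w y → R w z

TotalRel : ∀ {a ℓ} {X : Set a} → Rel X ℓ → Set (a ⊔ ℓ)
TotalRel {X = X} R = ∀ (x : X) → ∃[ y ] R x y

SurjectiveRel : ∀ {a ℓ} {X : Set a} → Rel X ℓ → Set (a ⊔ ℓ)
SurjectiveRel {X = X} R = ∀ (x : X) → ∃[ y ] R y x

record Collusion {a ℓ} {X : Set a} (R : Rel X ℓ) : Set (a ⊔ ℓ) where
  field
    collusive  : Collusive R
    total      : TotalRel R
    surjective : SurjectiveRel R

SymmetricRel : ∀ {a ℓ} {X : Set a} → Rel X ℓ → Set (a ⊔ ℓ)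
SymmetricRel {X = X} R = ∀ (x y : X) → R x y → R y x

IrreflexiveRel : ∀ {a ℓ} {X : Set a} → Rel X ℓ → Set (a ⊔ ℓ)
IrreflexiveRel {X = X} R = ∀ (x : X) → ¬ R x x

IsCycle : ∀ {a ℓ} {X : Set a} → Rel X ℓ → (n : ℕ) → (ℕ → X) → Set (a ⊔ ℓ)
IsCycle R n x = (x n ≡ x 0) × (∀ i → i < n → R (x i) (x (suc i)))

-- In a symmetric collusive relation a path of length three collapses to a single edge, so by
-- induction every walk of odd length does. An odd cycle thus yields an edge from x₀ to itself,
-- contradicting irreflexivity.
module Submission where

open import Defs
open import Data.Nat using (ℕ; zero; suc; _*_; _<_; z≤n; s≤s)
open import Data.Nat.Properties using (*-suc; m<n⇒m<1+n; n<1+n)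
open import Data.Product using (_,_)
open import Relation.Nullary using (¬_)
open import Relation.Binary.Core using (Rel)
open import Relation.Binary.PropositionalEquality using (subst)

module _ {a ℓ} {X : Set a} {R : Rel X ℓ} (symmetric : SymmetricRel R) (collusive : Collusive R) where

  path₃⇒edge : ∀ {p q r s} → R p q → R q r → R r s → R p s
  path₃⇒edge {p} {q} {r} {s} pq qr rs = collusive r q s p (symmetric q r qr) rs pq

  oddWalk⇒edge : ∀ k (x : ℕ → X) → (∀ i → i < suc (2 * k) → R (x i) (x (suc i))) →
                 R (x 0) (x (suc (2 * k)))
  oddWalk⇒edge zero    x step = step 0 (s≤s z≤n)
  oddWalk⇒edge (suc k) x step rewrite *-suc 2 k =
    path₃⇒edge (oddWalk⇒edge k x (λ i i<1+2k → step i (m<n⇒m<1+n (m<n⇒m<1+n i<1+2k))))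
               (step _ (m<n⇒m<1+n (n<1+n _)))
               (step _ (n<1+n _))

mainTheorem12 : ∀ {a ℓ} {X : Set a} (R : Rel X ℓ) → SymmetricRel R → IrreflexiveRel R → Collusion R →
    ∀ (k : ℕ) (x : ℕ → X) → ¬ IsCycle R (suc (2 * k)) x
mainTheorem12 R symmetric irreflexive collusion k x (closed , step) =
  irreflexive (x 0) (subst (R (x 0)) closed (oddWalk⇒edge symmetric (Collusion.collusive collusion) k x step))
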